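{- Let $G$ be a connected $d$-degenerate graph and let $k$ be a prime number with $k > d \ge 2$. Suppose that one of the following holds: (i) $G$ is non-bipartite; (ii) $G$ is bipartite and there are two non-adjacent vertices $u, v$ of $G$ with $d(u)+d(v) < k$. Then there is a square matrix $A$ with rows indexed by $E(G)$, each of whose columns is a linear combination with integer coefficients of the edge columns $A_G(e)$, $e\in E(G)$, such that $\operatorname{per}(A)\not\equiv 0 \pmod{k}$.
   Context: Graphs are finite and simple; $d(v)$ denotes the degree of $v$. A graph is $d$-degenerate if every subgraph has a vertex of degree at most $d$. Fix an orientation $D$ of $G$. $A_G$ is the matrix whose rows are indexed by $E(G)$ and whose columns are indexed by $V(G)\cup E(G)$, defined as follows: for an edge $e$ oriented from $u$ to $v$ and $z\in V(G)\cup E(G)$, $A_G[e,z]=1$ if $z=v$ or $z\neq e$ is an edge incident to $v$; $A_G[e,z]=-1$ if $z=u$ or $z\ne e$ is an edge incident to $u$; and $A_G[e,z]=0$ otherwise. $A_G(z)$ denotes the column of $A_G$ indexed by $z$; for $z\in E(G)$ it is called an edge column. $\operatorname{per}$ denotes the permanent. -}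

module Defs where

open import Data.Nat as ℕ using (ℕ; zero; suc)
open import Data.Integer as ℤ using (ℤ; 0ℤ; 1ℤ; -1ℤ)
open import Data.Fin using (Fin; zero; suc; punchIn; _≟_)
open import Data.Bool using (Bool; true; false; if_then_else_; _∨_)
open import Data.Product using (Σ; ∃; _×_; _,_; proj₁; proj₂)
open import Data.Sum using (_⊎_; inj₁; inj₂)
open import Relation.Nullary using (¬_; does)
open import Relation.Binary.PropositionalEquality using (_≡_; _≢_)

sumℕ : ∀ {m} → (Fin m → ℕ) → ℕ
sumℕ {zero} f = 0
sumℕ {suc m} f = f zero ℕ.+ sumℕ (λ i → f (suc i))

sumℤ : ∀ {m} → (Fin m → ℤ) → ℤ
sumℤ {zero} f = 0ℤ
sumℤ {suc m} f = f zero ℤ.+ sumℤ (λ i → f (suc i))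

-- Permanent of a square integer matrix (expansion along the first row,
-- which equals the sum over all permutations of products of entries).
per : ∀ {m} → (Fin m → Fin m → ℤ) → ℤ
per {zero} M = 1ℤ
per {suc m} M = sumℤ (λ j → M zero j ℤ.* per (λ i' j' → M (suc i') (punchIn j j')))

-- An oriented finite simple graph on vertex set Fin n with m edges.
-- Edge e is oriented from (tail e) to (head e).
record OGraph (n m : ℕ) : Set where
  field
    tail head : Fin m → Fin n
    loopless : ∀ e → tail e ≢ head e
    noParallel : ∀ e f → e ≢ f →
      ¬ ((tail e ≡ tail f × head e ≡ head f) ⊎ (tail e ≡ head f × head e ≡ tail f))
open OGraph public

module _ {n m : ℕ} (G : OGraph n m) where

  incident? : Fin n → Fin m → Bool
  incident? v e = does (tail G e ≟ v) ∨ does (head G e ≟ v)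

  Adjacent : Fin n → Fin n → Set
  Adjacent u v = ∃ λ e → (tail G e ≡ u × head G e ≡ v) ⊎ (tail G e ≡ v × head G e ≡ u)

  degree : Fin n → ℕ
  degree v = sumℕ (λ e → if incident? v e then 1 else 0)

  data Walk : Fin n → Fin n → Set where
    here : ∀ {u} → Walk u u
    step : ∀ {u v w} → Adjacent u v → Walk v w → Walk u w

  Connected : Set
  Connected = ∀ u v → Walk u v

  Bipartite : Set
  Bipartite = Σ (Fin n → Bool) λ c → ∀ e → c (tail G e) ≢ c (head G e)

  IsSubgraph : (Fin n → Bool) → (Fin m → Bool) → Set
  IsSubgraph S F = ∀ e → F e ≡ true → S (tail G e) ≡ true × S (head G e) ≡ true

  degreeIn : (Fin m → Bool) → Fin n → ℕ
  degreeIn F v = sumℕ (λ e → if F e then (if incident? v e then 1 else 0) else 0)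

  Degenerate : ℕ → Set
  Degenerate d = ∀ S F → IsSubgraph S F → (∃ λ v → S v ≡ true) →
                 ∃ λ v → S v ≡ true × degreeIn F v ℕ.≤ d

  AG : Fin m → (Fin n ⊎ Fin m) → ℤ
  AG e (inj₁ w) =
    if does (w ≟ head G e) then 1ℤ
    else if does (w ≟ tail G e) then -1ℤ
    else 0ℤ
  AG e (inj₂ f) =
    if does (f ≟ e) then 0ℤ
    else if incident? (head G e) f then 1ℤ
    else if incident? (tail G e) f then -1ℤ
    else 0ℤ

  EdgeColumnCombination : (Fin m → Fin m → ℤ) → Set
  EdgeColumnCombination A =
    ∃ λ (C : Fin m → Fin m → ℤ) →
      ∀ i j → A i j ≡ sumℤ (λ f → C f j ℤ.* AG i (inj₂ f))

-- A column Σ_g c_g A_G(g) is the vector (φ(head e) − φ(tail e))_e of the vertex potential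
-- φ = Σ_g c_g 1_g, and the alternating edge sum of a walk from a to b has potential δ_a ± δ_b.
-- Fix a root set R (a vertex z of degree ≤ d if G is not bipartite, the pair {u, v} otherwise) and
-- rank the other vertices 1, 2, … by repeatedly deleting a vertex of degree ≤ d from what remains,
-- so that each has at most d neighbours of higher rank.  Column type t ≥ 1 is the walk from the
-- vertex of rank t to a root; type 0 is a combination whose potential vanishes off R and is ±1 or ±2
-- on R (the walk from u to v, or an odd closed walk through z).  Giving each edge the type of its
-- lower-ranked end makes the matrix triangular, so its permanent is the product of the factorials of
-- the type multiplicities (at most d, or the number of edges at R) and of the diagonal entries
-- (±1 or ±2): none of these factors is divisible by k.

module Submission where

open import Defs
open import Data.Nat as ℕ using (ℕ; zero; suc; _+_; _∸_; _*_; _≤_; _<_; z≤n; s≤s)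
import Data.Nat.Properties as ℕₚ
open import Data.Nat.Primality using (Prime; euclidsLemma; ¬prime[1])
import Data.Nat.Divisibility as ℕ∣
open import Data.Integer as ℤ using (ℤ; +_; 0ℤ; 1ℤ; -1ℤ)
import Data.Integer.Properties as ℤₚ
open import Data.Integer.Divisibility using (_∣_)
open import Data.Integer.Tactic.RingSolver using (solve-∀)
open import Data.Fin using (Fin; zero; suc; punchIn; toℕ; fromℕ<; _≟_)
open import Data.Fin.Properties using (¬Fin0; toℕ-injective; toℕ-fromℕ<; any?)
import Data.Bool as Bool
open import Data.Bool using (Bool; true; false; if_then_else_; _∨_; _∧_; not)
import Data.Bool.Properties as Boolₚ
open import Data.Product using (∃; _×_; _,_; proj₁; proj₂)
open import Data.Sum using (_⊎_; inj₁; inj₂; swap)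
open import Data.Empty using (⊥-elim)
open import Function using (_∘_)
open import Relation.Nullary using (¬_; Dec; does; yes; no)
open import Relation.Nullary.Decidable using (dec-true; dec-false; _×-dec_; _⊎-dec_)
open import Relation.Binary.PropositionalEquality
open import Relation.Binary.Definitions using (tri<; tri≈; tri>)
import Algebra.Properties.CommutativeSemigroup as CommutativeSemigroupProperties
open import Algebra.Properties.Ring ℤₚ.+-*-ring using (x[y-z]≈xy-xz; [y-z]x≈yx-zx)

module ℕ+ = CommutativeSemigroupProperties ℕₚ.+-commutativeSemigroup
module ℤ+ = CommutativeSemigroupProperties ℤₚ.+-commutativeSemigroup

⟦_⟧ : Bool → ℕ
⟦ b ⟧ = if b then 1 else 0

indicator-≤ : ∀ {p} {P : Set p} (P? : Dec P) {n} → (P → 1 ≤ n) → ⟦ does P? ⟧ ≤ n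
indicator-≤ (yes p) 1≤n = 1≤n p
indicator-≤ (no _) _ = z≤n

1≤indicator : ∀ {p} {P : Set p} (P? : Dec P) → P → 1 ≤ ⟦ does P? ⟧
1≤indicator P? p rewrite dec-true P? p = ℕₚ.≤-refl

1≤⟦∨⟧ : ∀ {a b} → a ≡ true ⊎ b ≡ true → 1 ≤ ⟦ a ∨ b ⟧
1≤⟦∨⟧ (inj₁ refl) = ℕₚ.≤-refl
1≤⟦∨⟧ {a} (inj₂ refl) rewrite Boolₚ.∨-zeroʳ a = ℕₚ.≤-refl

⟦∨∨⟧≤ : ∀ a b c d → ⟦ (a ∨ b) ∨ (c ∨ d) ⟧ ≤ ⟦ a ∨ c ⟧ + ⟦ b ∨ d ⟧
⟦∨∨⟧≤ true b c d = s≤s z≤n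
⟦∨∨⟧≤ false true c d = ℕₚ.m≤n+m 1 ⟦ c ⟧
⟦∨∨⟧≤ false false true d = s≤s z≤n
⟦∨∨⟧≤ false false false true = ℕₚ.≤-refl
⟦∨∨⟧≤ false false false false = z≤n

δ : ∀ {T} → Fin T → Fin T → ℕ
δ a b = ⟦ does (a ≟ b) ⟧

δℤ : ∀ {T} → Fin T → Fin T → ℤ
δℤ a b = + δ a b

δ-refl : ∀ {T} (a : Fin T) → δ a a ≡ 1
δ-refl a = cong ⟦_⟧ (dec-true (a ≟ a) refl)

δ-≢ : ∀ {T} {a b : Fin T} → a ≢ b → δ a b ≡ 0
δ-≢ {a = a} {b} a≢b = cong ⟦_⟧ (dec-false (a ≟ b) a≢b)

δ≤ : ∀ {T} (c : Fin T → ℕ) {a} b → 1 ≤ c a → δ a b ≤ c b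
δ≤ c {a} b 1≤ca with a ≟ b
... | yes refl = 1≤ca
... | no _ = z≤n

≟-true⇒≡ : ∀ {T} {x y : Fin T} → does (x ≟ y) ≡ true → x ≡ y
≟-true⇒≡ {x = x} {y} eq with x ≟ y
... | yes x≡y = x≡y

sumℕ-cong : ∀ {m} {f g : Fin m → ℕ} → (∀ i → f i ≡ g i) → sumℕ f ≡ sumℕ g
sumℕ-cong {zero} f≗g = refl
sumℕ-cong {suc m} f≗g = cong₂ _+_ (f≗g zero) (sumℕ-cong (f≗g ∘ suc))

sumℕ-mono : ∀ {m} {f g : Fin m → ℕ} → (∀ i → f i ≤ g i) → sumℕ f ≤ sumℕ g
sumℕ-mono {zero} f≤g = z≤n
sumℕ-mono {suc m} f≤g = ℕₚ.+-mono-≤ (f≤g zero) (sumℕ-mono (f≤g ∘ suc))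

sumℕ-+ : ∀ {m} (f g : Fin m → ℕ) → sumℕ (λ i → f i + g i) ≡ sumℕ f + sumℕ g
sumℕ-+ {zero} f g = refl
sumℕ-+ {suc m} f g rewrite sumℕ-+ (f ∘ suc) (g ∘ suc) = ℕ+.interchange (f zero) (g zero) _ _

sumℕ-zero : ∀ {m} {f : Fin m → ℕ} → (∀ i → f i ≡ 0) → sumℕ f ≡ 0
sumℕ-zero {zero} f≗0 = refl
sumℕ-zero {suc m} f≗0 = cong₂ _+_ (f≗0 zero) (sumℕ-zero (f≗0 ∘ suc))

sumℕ-δ : ∀ {T} (a : Fin T) (h : Fin T → ℕ) → sumℕ (λ t → δ a t * h t) ≡ h a
sumℕ-δ {suc T} zero h =
  trans (cong₂ _+_ (ℕₚ.+-identityʳ (h zero)) (sumℕ-zero {T} (λ _ → refl))) (ℕₚ.+-identityʳ (h zero))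
sumℕ-δ {suc T} (suc a) h = sumℕ-δ a (h ∘ suc)

sumℤ-cong : ∀ {m} {f g : Fin m → ℤ} → (∀ i → f i ≡ g i) → sumℤ f ≡ sumℤ g
sumℤ-cong {zero} f≗g = refl
sumℤ-cong {suc m} f≗g = cong₂ ℤ._+_ (f≗g zero) (sumℤ-cong (f≗g ∘ suc))

sumℤ-zero : ∀ {m} {f : Fin m → ℤ} → (∀ i → f i ≡ 0ℤ) → sumℤ f ≡ 0ℤ
sumℤ-zero {zero} f≗0 = refl
sumℤ-zero {suc m} f≗0 = cong₂ ℤ._+_ (f≗0 zero) (sumℤ-zero (f≗0 ∘ suc))

sumℤ-+ : ∀ {m} (f g : Fin m → ℤ) → sumℤ (λ i → f i ℤ.+ g i) ≡ sumℤ f ℤ.+ sumℤ g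
sumℤ-+ {zero} f g = refl
sumℤ-+ {suc m} f g rewrite sumℤ-+ (f ∘ suc) (g ∘ suc) = ℤ+.interchange (f zero) (g zero) _ _

sumℤ-- : ∀ {m} (f g : Fin m → ℤ) → sumℤ (λ i → f i ℤ.- g i) ≡ sumℤ f ℤ.- sumℤ g
sumℤ-- {zero} f g = refl
sumℤ-- {suc m} f g rewrite sumℤ-- (f ∘ suc) (g ∘ suc) = regroup (f zero) (g zero) _ _
  where
  regroup : ∀ a b c d → (a ℤ.- b) ℤ.+ (c ℤ.- d) ≡ (a ℤ.+ c) ℤ.- (b ℤ.+ d)
  regroup = solve-∀

sumℤ-δ : ∀ {T} (a : Fin T) (h : Fin T → ℤ) → sumℤ (λ t → δℤ a t ℤ.* h t) ≡ h a
sumℤ-δ {suc T} zero h =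
  trans (cong₂ ℤ._+_ (ℤₚ.*-identityˡ (h zero)) (sumℤ-zero {T} (λ _ → refl))) (ℤₚ.+-identityʳ (h zero))
sumℤ-δ {suc T} (suc a) h = trans (ℤₚ.+-identityˡ _) (sumℤ-δ a (h ∘ suc))

sumℤ-single : ∀ {T} (h : Fin T → ℤ) a → (∀ t → t ≢ a → h t ≡ 0ℤ) → sumℤ h ≡ h a
sumℤ-single h a vanishes = trans (sumℤ-cong δ-weighted) (sumℤ-δ a h)
  where
  δ-weighted : ∀ t → h t ≡ δℤ a t ℤ.* h t
  δ-weighted t with a ≟ t
  ... | yes refl = sym (ℤₚ.*-identityˡ (h t))
  ... | no a≢t = vanishes t (a≢t ∘ sym)

size : ∀ {n} → (Fin n → Bool) → ℕ
size S = sumℕ (λ x → ⟦ S x ⟧)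

remove : ∀ {n} → (Fin n → Bool) → Fin n → Fin n → Bool
remove S v y = S y ∧ not (does (y ≟ v))

size-remove : ∀ {n} (S : Fin n → Bool) v → S v ≡ true → size S ≡ suc (size (remove S v))
size-remove S zero Sv rewrite Sv =
  cong suc (sumℕ-cong (λ i → cong ⟦_⟧ (sym (Boolₚ.∧-identityʳ (S (suc i))))))
size-remove S (suc v) Sv rewrite Boolₚ.∧-identityʳ (S zero) =
  trans (cong (⟦ S zero ⟧ ℕ.+_) (size-remove (S ∘ suc) v Sv)) (ℕₚ.+-suc ⟦ S zero ⟧ _)

-- Divisibility by a prime

∤-small : ∀ {k} x → 0 < ℤ.∣ x ∣ → ℤ.∣ x ∣ < k → ¬ (+ k ∣ x)
∤-small x 0<∣x∣ ∣x∣<k k∣x = ℕₚ.<⇒≱ ∣x∣<k (ℕ∣.∣⇒≤ {{ℕ.>-nonZero 0<∣x∣}} k∣x)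

∤-* : ∀ {k} → Prime k → ∀ x y → ¬ (+ k ∣ x) → ¬ (+ k ∣ y) → ¬ (+ k ∣ x ℤ.* y)
∤-* k-prime x y k∤x k∤y k∣xy
  with euclidsLemma ℤ.∣ x ∣ ℤ.∣ y ∣ k-prime (subst (_ ℕ∣.∣_) (ℤₚ.abs-* x y) k∣xy)
... | inj₁ k∣x = k∤x k∣x
... | inj₂ k∣y = k∤y k∣y

∤-unit : ∀ {k} → Prime k → ∀ x → ℤ.∣ x ∣ ≡ 1 → ¬ (+ k ∣ x)
∤-unit {k} k-prime _ ∣x∣≡1 k∣x =
  ¬prime[1] (subst Prime (ℕ∣.∣1⇒≡1 (subst (k ℕ∣.∣_) ∣x∣≡1 k∣x)) k-prime)

∤-difference : ∀ {k} (x y : ℤ) → (x ≡ 0ℤ × ¬ (+ k ∣ y)) ⊎ (y ≡ 0ℤ × ¬ (+ k ∣ x)) →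
               ¬ (+ k ∣ x ℤ.- y)
∤-difference {k} _ y (inj₁ (refl , k∤y)) =
  k∤y ∘ subst (k ℕ∣.∣_) (trans (cong ℤ.∣_∣ (ℤₚ.+-identityˡ (ℤ.- y))) (ℤₚ.∣-i∣≡∣i∣ y))
∤-difference {k} x _ (inj₂ (refl , k∤x)) = k∤x ∘ subst (λ z → + k ∣ z) (ℤₚ.+-identityʳ x)

-- Permanents of matrices with repeated columns

count : ∀ {m T} → (Fin m → Fin T) → Fin T → ℕ
count γ t = sumℕ (λ j → δ (γ j) t)

removeOne : ∀ {T} → (Fin T → ℕ) → Fin T → Fin T → ℕ
removeOne c t t′ = c t′ ∸ δ t t′

-- The permanent of the square matrix with rows f i and c t columns of type t, expanded along row 0.
perCount : ∀ {m T} → (Fin m → Fin T → ℤ) → (Fin T → ℕ) → ℤ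
perCount {zero} f c = 1ℤ
perCount {suc m} f c = sumℤ (λ t → + c t ℤ.* (f zero t ℤ.* perCount (f ∘ suc) (removeOne c t)))

perCount-cong : ∀ {m T} (f : Fin m → Fin T → ℤ) {c c′ : Fin T → ℕ} →
                (∀ t → c t ≡ c′ t) → perCount f c ≡ perCount f c′
perCount-cong {zero} f c≗c′ = refl
perCount-cong {suc m} f c≗c′ = sumℤ-cong λ t →
  cong₂ (λ x y → + x ℤ.* (f zero t ℤ.* y)) (c≗c′ t)
        (perCount-cong (f ∘ suc) (λ t′ → cong (_∸ δ t t′) (c≗c′ t′)))

count-punchIn : ∀ {m T} (γ : Fin (suc m) → Fin T) j t →
                count γ t ≡ δ (γ j) t + count (γ ∘ punchIn j) t
count-punchIn γ zero t = refl
count-punchIn {suc m} γ (suc j) t = begin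
  δ (γ zero) t + count (γ ∘ suc) t
    ≡⟨ cong (δ (γ zero) t ℕ.+_) (count-punchIn (γ ∘ suc) j t) ⟩
  δ (γ zero) t + (δ (γ (suc j)) t + count (γ ∘ suc ∘ punchIn j) t)
    ≡⟨ ℕ+.x∙yz≈y∙xz (δ (γ zero) t) (δ (γ (suc j)) t) _ ⟩
  δ (γ (suc j)) t + (δ (γ zero) t + count (γ ∘ suc ∘ punchIn j) t) ∎
  where open ≡-Reasoning

count-removeOne : ∀ {m T} (γ : Fin (suc m) → Fin T) j t →
                  removeOne (count γ) (γ j) t ≡ count (γ ∘ punchIn j) t
count-removeOne γ j t =
  trans (cong (_∸ δ (γ j) t) (count-punchIn γ j t)) (ℕₚ.m+n∸m≡n (δ (γ j) t) _)

sumℤ-byType : ∀ {m T} (γ : Fin m → Fin T) (h : Fin T → ℤ) →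
              sumℤ (h ∘ γ) ≡ sumℤ (λ t → + count γ t ℤ.* h t)
sumℤ-byType {zero} {T} γ h = sym (sumℤ-zero {T} (λ _ → refl))
sumℤ-byType {suc m} {T} γ h = begin
  h (γ zero) ℤ.+ sumℤ (h ∘ γ ∘ suc)
    ≡⟨ cong₂ ℤ._+_ (sym (sumℤ-δ (γ zero) h)) (sumℤ-byType (γ ∘ suc) h) ⟩
  sumℤ (λ t → δℤ (γ zero) t ℤ.* h t) ℤ.+ sumℤ (λ t → + count (γ ∘ suc) t ℤ.* h t)
    ≡⟨ sumℤ-+ {T} (λ t → δℤ (γ zero) t ℤ.* h t) _ ⟨
  sumℤ (λ t → δℤ (γ zero) t ℤ.* h t ℤ.+ + count (γ ∘ suc) t ℤ.* h t)
    ≡⟨ sumℤ-cong (λ t → sym (ℤₚ.*-distribʳ-+ (h t) (δℤ (γ zero) t) (+ count (γ ∘ suc) t))) ⟩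
  sumℤ (λ t → + count γ t ℤ.* h t) ∎
  where open ≡-Reasoning

per≡perCount : ∀ {m T} (f : Fin m → Fin T → ℤ) (γ : Fin m → Fin T) →
               per (λ i j → f i (γ j)) ≡ perCount f (count γ)
per≡perCount {zero} f γ = refl
per≡perCount {suc m} f γ = begin
  sumℤ (λ j → f zero (γ j) ℤ.* per (λ i′ j′ → f (suc i′) (γ (punchIn j j′))))
    ≡⟨ sumℤ-cong (λ j → cong (f zero (γ j) ℤ.*_) (minor j)) ⟩
  sumℤ (expansion ∘ γ)
    ≡⟨ sumℤ-byType γ expansion ⟩
  perCount f (count γ) ∎
  where
  open ≡-Reasoning
  expansion : _ → ℤ
  expansion t = f zero t ℤ.* perCount (f ∘ suc) (removeOne (count γ) t)
  minor : ∀ j → per (λ i′ j′ → f (suc i′) (γ (punchIn j j′)))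
                ≡ perCount (f ∘ suc) (removeOne (count γ) (γ j))
  minor j = trans (per≡perCount (f ∘ suc) (γ ∘ punchIn j))
                  (perCount-cong (f ∘ suc) (λ t → sym (count-removeOne γ j t)))

weight : ∀ {T} → (Fin T → ℕ) → ℕ
weight c = sumℕ (λ t → c t * toℕ t)

height : ∀ {m T} → (Fin m → Fin T) → ℕ
height β = sumℕ (toℕ ∘ β)

weight-count : ∀ {m T} (β : Fin m → Fin T) → weight (count β) ≡ height β
weight-count {zero} {T} β = sumℕ-zero {T} (λ _ → refl)
weight-count {suc m} {T} β = begin
  sumℕ (λ t → (δ (β zero) t + count (β ∘ suc) t) * toℕ t)
    ≡⟨ sumℕ-cong (λ t → ℕₚ.*-distribʳ-+ (toℕ t) (δ (β zero) t) (count (β ∘ suc) t)) ⟩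
  sumℕ (λ t → δ (β zero) t * toℕ t + count (β ∘ suc) t * toℕ t)
    ≡⟨ sumℕ-+ {T} (λ t → δ (β zero) t * toℕ t) _ ⟩
  sumℕ (λ t → δ (β zero) t * toℕ t) + weight (count (β ∘ suc))
    ≡⟨ cong₂ _+_ (sumℕ-δ (β zero) toℕ) (weight-count (β ∘ suc)) ⟩
  height β ∎
  where open ≡-Reasoning

weight-removeOne : ∀ {T} (c : Fin T → ℕ) t → 1 ≤ c t →
                   weight (removeOne c t) + toℕ t ≡ weight c
weight-removeOne {T} c t 1≤ct = begin
  weight (removeOne c t) + toℕ t
    ≡⟨ cong (weight (removeOne c t) ℕ.+_) (sumℕ-δ t toℕ) ⟨
  weight (removeOne c t) + sumℕ (λ t′ → δ t t′ * toℕ t′)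
    ≡⟨ sumℕ-+ {T} (λ t′ → removeOne c t t′ * toℕ t′) _ ⟨
  sumℕ (λ t′ → removeOne c t t′ * toℕ t′ + δ t t′ * toℕ t′)
    ≡⟨ sumℕ-cong restore ⟩
  weight c ∎
  where
  open ≡-Reasoning
  restore : ∀ t′ → (c t′ ∸ δ t t′) * toℕ t′ + δ t t′ * toℕ t′ ≡ c t′ * toℕ t′
  restore t′ = trans (cong (_+ δ t t′ * toℕ t′) (ℕₚ.*-distribʳ-∸ (toℕ t′) (c t′) (δ t t′)))
                     (ℕₚ.m∸n+n≡m (ℕₚ.*-monoˡ-≤ (toℕ t′) (δ≤ c t′ 1≤ct)))

Triangular : ∀ {m T} → (Fin m → Fin T → ℤ) → (Fin m → Fin T) → Set
Triangular f β = ∀ i t → toℕ t < toℕ (β i) → f i t ≡ 0ℤ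

pos*≡0 : ∀ n {x} → (1 ≤ n → x ≡ 0ℤ) → + n ℤ.* x ≡ 0ℤ
pos*≡0 zero _ = refl
pos*≡0 (suc n) x≡0 = trans (cong (+ suc n ℤ.*_) (x≡0 (s≤s z≤n))) (ℤₚ.*-zeroʳ (+ suc n))

firstRowTerm-vanishes : ∀ {m T} {f : Fin (suc m) → Fin T → ℤ} {β} → Triangular f β → ∀ c t →
  (toℕ (β zero) ≤ toℕ t → 1 ≤ c t → perCount (f ∘ suc) (removeOne c t) ≡ 0ℤ) →
  + c t ℤ.* (f zero t ℤ.* perCount (f ∘ suc) (removeOne c t)) ≡ 0ℤ
firstRowTerm-vanishes {f = f} {β} tri c t minor≡0 with toℕ t ℕ.<? toℕ (β zero)
... | yes t<β₀ =
  trans (cong (λ y → + c t ℤ.* (y ℤ.* perCount (f ∘ suc) (removeOne c t))) (tri zero t t<β₀))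
        (ℤₚ.*-zeroʳ (+ c t))
... | no t≮β₀ = pos*≡0 (c t) λ 1≤ct →
  trans (cong (f zero t ℤ.*_) (minor≡0 (ℕₚ.≮⇒≥ t≮β₀) 1≤ct)) (ℤₚ.*-zeroʳ (f zero t))

-- A nonzero term gives each row i a column of type t ≥ β i, so these types weigh at least height β.
perCount-vanishes : ∀ {m T} {f : Fin m → Fin T → ℤ} {β} → Triangular f β →
                    ∀ c → weight c < height β → perCount f c ≡ 0ℤ
perCount-vanishes {zero} tri c ()
perCount-vanishes {suc m} {T} {β = β} tri c w<h = sumℤ-zero λ t →
  firstRowTerm-vanishes tri c t λ β₀≤t 1≤ct →
    perCount-vanishes (tri ∘ suc) (removeOne c t) (lighter t β₀≤t 1≤ct)
  where
  open ℕₚ.≤-Reasoning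
  lighter : ∀ t → toℕ (β zero) ≤ toℕ t → 1 ≤ c t → weight (removeOne c t) < height (β ∘ suc)
  lighter t β₀≤t 1≤ct = ℕₚ.+-cancelʳ-< (toℕ (β zero)) _ _ (begin-strict
    weight (removeOne c t) + toℕ (β zero) ≤⟨ ℕₚ.+-monoʳ-≤ (weight (removeOne c t)) β₀≤t ⟩
    weight (removeOne c t) + toℕ t       ≡⟨ weight-removeOne c t 1≤ct ⟩
    weight c                             <⟨ w<h ⟩
    toℕ (β zero) + height (β ∘ suc)      ≡⟨ ℕₚ.+-comm (toℕ (β zero)) _ ⟩
    height (β ∘ suc) + toℕ (β zero)      ∎)

perCount-∤ : ∀ {m T k} {f : Fin m → Fin T → ℤ} {β} → Prime k → Triangular f β →
             (∀ t → count β t < k) → (∀ i → ¬ (+ k ∣ f i (β i))) → ¬ (+ k ∣ perCount f (count β))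
perCount-∤ {zero} k-prime tri count<k k∤diag = ∤-unit k-prime 1ℤ refl
perCount-∤ {suc m} {T} {k} {f} {β} k-prime tri count<k k∤diag k∣per =
  k∤term (subst (+ k ∣_) (sumℤ-single term β₀ off-diagonal) k∣per)
  where
  β₀ = β zero
  minor = perCount (f ∘ suc) (removeOne (count β) β₀)
  term : Fin T → ℤ
  term t = + count β t ℤ.* (f zero t ℤ.* perCount (f ∘ suc) (removeOne (count β) t))
  k∤count : ¬ (+ k ∣ + count β β₀)
  k∤count = ∤-small (+ count β β₀) (subst (0 <_) (sym count-β₀) (s≤s z≤n)) (count<k β₀)
    where count-β₀ = cong (_+ count (β ∘ suc) β₀) (δ-refl β₀)
  k∤minor : ¬ (+ k ∣ minor)
  k∤minor = subst (λ x → ¬ (+ k ∣ x)) (perCount-cong (f ∘ suc) (λ t → sym (count-removeOne β zero t)))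
    (perCount-∤ k-prime (tri ∘ suc) (λ t → ℕₚ.≤-<-trans (ℕₚ.m≤n+m _ (δ β₀ t)) (count<k t))
                (k∤diag ∘ suc))
  k∤term : ¬ (+ k ∣ term β₀)
  k∤term = ∤-* k-prime (+ count β β₀) _ k∤count
                 (∤-* k-prime (f zero β₀) minor (k∤diag zero) k∤minor)
  open ℕₚ.≤-Reasoning
  off-diagonal : ∀ t → t ≢ β₀ → term t ≡ 0ℤ
  off-diagonal t t≢β₀ = firstRowTerm-vanishes tri (count β) t λ β₀≤t 1≤ct →
    perCount-vanishes (tri ∘ suc) (removeOne (count β) t) (ℕₚ.+-cancelʳ-< (toℕ t) _ _ (begin-strict
      weight (removeOne (count β) t) + toℕ t ≡⟨ weight-removeOne (count β) t 1≤ct ⟩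
      weight (count β)                       ≡⟨ weight-count β ⟩
      toℕ β₀ + height (β ∘ suc)
        <⟨ ℕₚ.+-monoˡ-< _ (ℕₚ.≤∧≢⇒< β₀≤t (t≢β₀ ∘ sym ∘ toℕ-injective)) ⟩
      toℕ t + height (β ∘ suc)               ≡⟨ ℕₚ.+-comm (toℕ t) _ ⟩
      height (β ∘ suc) + toℕ t               ∎))

per-triangular-∤ : ∀ {m T k} (f : Fin m → Fin T → ℤ) (β : Fin m → Fin T) → Prime k → Triangular f β →
                   (∀ t → count β t < k) → (∀ i → ¬ (+ k ∣ f i (β i))) →
                   ¬ (+ k ∣ per (λ i j → f i (β j)))
per-triangular-∤ {k = k} f β k-prime tri count<k k∤diag =
  subst (λ x → ¬ (+ k ∣ x)) (sym (per≡perCount f β)) (perCount-∤ k-prime tri count<k k∤diag)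

-- Potentials of edge combinations

module _ {n m : ℕ} (G : OGraph n m) where

  incident?-tail : ∀ e → incident? G (tail G e) e ≡ true
  incident?-tail e rewrite dec-true (tail G e ≟ tail G e) refl = refl

  incident?-head : ∀ e → incident? G (head G e) e ≡ true
  incident?-head e rewrite dec-true (head G e ≟ head G e) refl = Boolₚ.∨-zeroʳ _

  incident?⇒endpoint : ∀ x e → incident? G x e ≡ true → tail G e ≡ x ⊎ head G e ≡ x
  incident?⇒endpoint x e _ with tail G e ≟ x | head G e ≟ x
  incident?⇒endpoint x e _  | yes t≡x | _ = inj₁ t≡x
  incident?⇒endpoint x e _  | no _ | yes h≡x = inj₂ h≡x
  incident?⇒endpoint x e () | no _ | no _

  Joins : Fin m → Fin n → Fin n → Set
  Joins e x y = (tail G e ≡ x × head G e ≡ y) ⊎ (tail G e ≡ y × head G e ≡ x)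

  joins⇒≢ : ∀ {e x y} → Joins e x y → x ≢ y
  joins⇒≢ {e} (inj₁ (t≡x , h≡y)) x≡y = loopless G e (trans t≡x (trans x≡y (sym h≡y)))
  joins⇒≢ {e} (inj₂ (t≡y , h≡x)) x≡y = loopless G e (trans t≡y (trans (sym x≡y) (sym h≡x)))

  incidence-split : ∀ x e → + ⟦ incident? G x e ⟧ ≡ δℤ (tail G e) x ℤ.+ δℤ (head G e) x
  incidence-split x e with tail G e ≟ x | head G e ≟ x
  ... | yes t≡x | yes h≡x = ⊥-elim (loopless G e (trans t≡x (sym h≡x)))
  ... | yes _ | no _ = refl
  ... | no _ | yes _ = refl
  ... | no _ | no _ = refl

  -- In a simple graph no edge other than i meets both ends of i.
  AG-edgeColumn : ∀ i g →
                  AG G i (inj₂ g) ≡ + ⟦ incident? G (head G i) g ⟧ ℤ.- + ⟦ incident? G (tail G i) g ⟧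
  AG-edgeColumn i g with g ≟ i
  ... | yes refl rewrite incident?-head g | incident?-tail g = refl
  ... | no g≢i with incident? G (head G i) g in meets-head | incident? G (tail G i) g in meets-tail
  ...   | true  | false = refl
  ...   | false | true  = refl
  ...   | false | false = refl
  ...   | true  | true
    with incident?⇒endpoint _ g meets-head | incident?⇒endpoint _ g meets-tail
  ...   | inj₁ t≡h | inj₁ t≡t = ⊥-elim (loopless G i (trans (sym t≡t) t≡h))
  ...   | inj₂ h≡h | inj₂ h≡t = ⊥-elim (loopless G i (trans (sym h≡t) h≡h))
  ...   | inj₁ t≡h | inj₂ h≡t = ⊥-elim (noParallel G i g (g≢i ∘ sym) (inj₂ (sym h≡t , sym t≡h)))
  ...   | inj₂ h≡h | inj₁ t≡t = ⊥-elim (noParallel G i g (g≢i ∘ sym) (inj₁ (sym t≡t , sym h≡h)))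

  potential : (Fin m → ℤ) → Fin n → ℤ
  potential c x = sumℤ (λ g → c g ℤ.* + ⟦ incident? G x g ⟧)

  potential-- : ∀ a b x → potential (λ g → a g ℤ.- b g) x ≡ potential a x ℤ.- potential b x
  potential-- a b x = trans (sumℤ-cong (λ g → [y-z]x≈yx-zx (+ ⟦ incident? G x g ⟧) (a g) (b g)))
                            (sumℤ-- (λ g → a g ℤ.* + ⟦ incident? G x g ⟧) _)

  edgeColumns≡potentialDifference : ∀ c i →
    sumℤ (λ g → c g ℤ.* AG G i (inj₂ g)) ≡ potential c (head G i) ℤ.- potential c (tail G i)
  edgeColumns≡potentialDifference c i = begin
    sumℤ (λ g → c g ℤ.* AG G i (inj₂ g))
      ≡⟨ sumℤ-cong (λ g → cong (c g ℤ.*_) (AG-edgeColumn i g)) ⟩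
    sumℤ (λ g → c g ℤ.* (+ ⟦ incident? G (head G i) g ⟧ ℤ.- + ⟦ incident? G (tail G i) g ⟧))
      ≡⟨ sumℤ-cong (λ g → x[y-z]≈xy-xz (c g) _ _) ⟩
    sumℤ (λ g → c g ℤ.* + ⟦ incident? G (head G i) g ⟧ ℤ.- c g ℤ.* + ⟦ incident? G (tail G i) g ⟧)
      ≡⟨ sumℤ-- (λ g → c g ℤ.* + ⟦ incident? G (head G i) g ⟧) _ ⟩
    potential c (head G i) ℤ.- potential c (tail G i) ∎
    where open ≡-Reasoning

  potential-edge : ∀ {u v} e → Joins e u v →
                   ∀ x → potential (λ g → δℤ e g) x ≡ δℤ u x ℤ.+ δℤ v x
  potential-edge e ends x =
    trans (sumℤ-δ e (λ g → + ⟦ incident? G x g ⟧)) (trans (incidence-split x e) (joins ends))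
    where
    joins : _ → δℤ (tail G e) x ℤ.+ δℤ (head G e) x ≡ _
    joins (inj₁ (refl , refl)) = refl
    joins (inj₂ (refl , refl)) = ℤₚ.+-comm (δℤ (tail G e) x) (δℤ (head G e) x)

  walkVector : ∀ {a b} → Walk G a b → Fin m → ℤ
  walkVector here g = 0ℤ
  walkVector (step (e , _) W) g = δℤ e g ℤ.- walkVector W g

  oddLength : ∀ {a b} → Walk G a b → Bool
  oddLength here = false
  oddLength (step _ W) = not (oddLength W)

  walkSign : ∀ {a b} → Walk G a b → ℤ
  walkSign W = if oddLength W then 1ℤ else -1ℤ

  ∣walkSign∣≡1 : ∀ {a b} (W : Walk G a b) → ℤ.∣ walkSign W ∣ ≡ 1
  ∣walkSign∣≡1 W with oddLength W
  ... | true = refl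
  ... | false = refl

  ∣walkSign+walkSign∣≡2 : ∀ {a b} (W : Walk G a b) → ℤ.∣ walkSign W ℤ.+ walkSign W ∣ ≡ 2
  ∣walkSign+walkSign∣≡2 W with oddLength W
  ... | true = refl
  ... | false = refl

  walkSign-step : ∀ {a a′ b} (p : Adjacent G a a′) (W : Walk G a′ b) →
                  walkSign (step p W) ≡ ℤ.- walkSign W
  walkSign-step p W with oddLength W
  ... | true = refl
  ... | false = refl

  potential-walk : ∀ {a b} (W : Walk G a b) x →
                   potential (walkVector W) x ≡ δℤ a x ℤ.+ walkSign W ℤ.* δℤ b x
  potential-walk {a} here x = begin
    sumℤ (λ g → 0ℤ ℤ.* + ⟦ incident? G x g ⟧) ≡⟨ sumℤ-zero {m} (λ _ → refl) ⟩
    0ℤ                                        ≡⟨ ℤₚ.+-inverseʳ (δℤ a x) ⟨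
    δℤ a x ℤ.- δℤ a x                         ≡⟨ cong (λ y → δℤ a x ℤ.+ y) (ℤₚ.-1*i≡-i (δℤ a x)) ⟨
    δℤ a x ℤ.+ -1ℤ ℤ.* δℤ a x                 ∎
    where open ≡-Reasoning
  potential-walk {a} {b} (step {v = a′} p@(e , ends) W) x = begin
    potential (λ g → δℤ e g ℤ.- walkVector W g) x
      ≡⟨ potential-- (λ g → δℤ e g) (walkVector W) x ⟩
    potential (λ g → δℤ e g) x ℤ.- potential (walkVector W) x
      ≡⟨ cong₂ ℤ._-_ (potential-edge e ends x) (potential-walk W x) ⟩
    (δℤ a x ℤ.+ δℤ a′ x) ℤ.- (δℤ a′ x ℤ.+ walkSign W ℤ.* δℤ b x)
      ≡⟨ telescope (δℤ a x) (δℤ a′ x) (walkSign W) (δℤ b x) ⟩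
    δℤ a x ℤ.+ ℤ.- walkSign W ℤ.* δℤ b x
      ≡⟨ cong (λ s → δℤ a x ℤ.+ s ℤ.* δℤ b x) (walkSign-step p W) ⟨
    δℤ a x ℤ.+ walkSign (step p W) ℤ.* δℤ b x ∎
    where
    open ≡-Reasoning
    telescope : ∀ p q s r → (p ℤ.+ q) ℤ.- (q ℤ.+ s ℤ.* r) ≡ p ℤ.+ ℤ.- s ℤ.* r
    telescope = solve-∀

  potential-walk-away : ∀ {a b} (W : Walk G a b) x → a ≢ x → b ≢ x →
                        potential (walkVector W) x ≡ 0ℤ
  potential-walk-away {a} {b} W x a≢x b≢x = begin
    potential (walkVector W) x         ≡⟨ potential-walk W x ⟩
    δℤ a x ℤ.+ walkSign W ℤ.* δℤ b x
      ≡⟨ cong₂ (λ p q → + p ℤ.+ walkSign W ℤ.* + q) (δ-≢ a≢x) (δ-≢ b≢x) ⟩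
    0ℤ ℤ.+ walkSign W ℤ.* 0ℤ           ≡⟨ ℤₚ.+-identityˡ _ ⟩
    walkSign W ℤ.* 0ℤ                  ≡⟨ ℤₚ.*-zeroʳ (walkSign W) ⟩
    0ℤ                                 ∎
    where open ≡-Reasoning

  potential-walk-start : ∀ {a b} (W : Walk G a b) → a ≢ b → potential (walkVector W) a ≡ 1ℤ
  potential-walk-start {a} {b} W a≢b = begin
    potential (walkVector W) a         ≡⟨ potential-walk W a ⟩
    δℤ a a ℤ.+ walkSign W ℤ.* δℤ b a
      ≡⟨ cong₂ (λ p q → + p ℤ.+ walkSign W ℤ.* + q) (δ-refl a) (δ-≢ (a≢b ∘ sym)) ⟩
    1ℤ ℤ.+ walkSign W ℤ.* 0ℤ           ≡⟨ cong (λ y → 1ℤ ℤ.+ y) (ℤₚ.*-zeroʳ (walkSign W)) ⟩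
    1ℤ                                 ∎
    where open ≡-Reasoning

  potential-walk-end : ∀ {a b} (W : Walk G a b) → a ≢ b → potential (walkVector W) b ≡ walkSign W
  potential-walk-end {a} {b} W a≢b = begin
    potential (walkVector W) b         ≡⟨ potential-walk W b ⟩
    δℤ a b ℤ.+ walkSign W ℤ.* δℤ b b
      ≡⟨ cong₂ (λ p q → + p ℤ.+ walkSign W ℤ.* + q) (δ-≢ a≢b) (δ-refl b) ⟩
    0ℤ ℤ.+ walkSign W ℤ.* 1ℤ           ≡⟨ ℤₚ.+-identityˡ _ ⟩
    walkSign W ℤ.* 1ℤ                  ≡⟨ ℤₚ.*-identityʳ (walkSign W) ⟩
    walkSign W                         ∎
    where open ≡-Reasoning

  -- Degeneracy rankings

  UpEdge : (Fin n → ℕ) → Fin n → Fin m → Set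
  UpEdge r x e = (tail G e ≡ x × r x < r (head G e)) ⊎ (head G e ≡ x × r x < r (tail G e))

  upEdge? : ∀ r x e → Dec (UpEdge r x e)
  upEdge? r x e = (tail G e ≟ x ×-dec r x ℕ.<? r (head G e))
            ⊎-dec (head G e ≟ x ×-dec r x ℕ.<? r (tail G e))

  upDegree : (Fin n → ℕ) → Fin n → ℕ
  upDegree r x = sumℕ (λ e → ⟦ does (upEdge? r x e) ⟧)

  inducedEdges : (Fin n → Bool) → Fin m → Bool
  inducedEdges S e = S (tail G e) ∧ S (head G e)

  inducedEdges-isSubgraph : ∀ S → IsSubgraph G S (inducedEdges S)
  inducedEdges-isSubgraph S e both = Boolₚ.∧-conicalˡ _ _ both , Boolₚ.∧-conicalʳ _ _ both

  inducedDegree-term : ∀ S x e → S (tail G e) ≡ true → S (head G e) ≡ true → incident? G x e ≡ true →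
                       1 ≤ (if inducedEdges S e then ⟦ incident? G x e ⟧ else 0)
  inducedDegree-term S x e St Sh x∈e rewrite St | Sh | x∈e = ℕₚ.≤-refl

  record IsRanking (d : ℕ) (S : Fin n → Bool) (cur bound : ℕ) (r : Fin n → ℕ) : Set where
    field
      outside   : ∀ x → S x ≡ false → r x ≡ 0
      inside    : ∀ x → S x ≡ true → cur ≤ r x
      bounded   : ∀ x → r x ≤ bound
      injective : ∀ x y → 1 ≤ r x → r x ≡ r y → x ≡ y
      sparse    : ∀ x → 1 ≤ r x → upDegree r x ≤ d

    ranked⇒member : ∀ x → 1 ≤ r x → S x ≡ true
    ranked⇒member x 1≤rx with S x in Sx
    ... | true = refl
    ... | false = ⊥-elim (ℕₚ.<⇒≢ 1≤rx (sym (outside x Sx)))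

  module DegeneracyRanking {d} (degenerate : Degenerate G d) where

    emptyRanking : ∀ S cur bound → ¬ (∃ λ x → S x ≡ true) → IsRanking d S cur bound (λ _ → 0)
    emptyRanking S cur bound S-empty = record
      { outside = λ _ _ → refl
      ; inside = λ x Sx → ⊥-elim (S-empty (x , Sx))
      ; bounded = λ _ → z≤n
      ; injective = λ _ _ ()
      ; sparse = λ _ ()
      }

    assign : Fin n → ℕ → (Fin n → ℕ) → Fin n → ℕ
    assign v c r y = if does (y ≟ v) then c else r y

    assign-≡ : ∀ v c r → assign v c r v ≡ c
    assign-≡ v c r rewrite dec-true (v ≟ v) refl = refl

    assign-≢ : ∀ {v y} c r → y ≢ v → assign v c r y ≡ r y
    assign-≢ {v} {y} c r y≢v rewrite dec-false (y ≟ v) y≢v = refl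

    -- The up-edges of v stay inside S, where v has degree at most d.
    rankFirst : ∀ {S cur bound r} v → S v ≡ true → degreeIn G (inducedEdges S) v ≤ d → cur ≤ bound →
                IsRanking d (remove S v) (suc cur) bound r → IsRanking d S cur bound (assign v cur r)
    rankFirst {S} {cur} {bound} {r} v Sv v-sparse cur≤bound rest = record
      { outside = outside
      ; inside = inside
      ; bounded = bounded
      ; injective = injective
      ; sparse = sparse
      }
      where
      module R = IsRanking rest
      ρ = assign v cur r

      rest-member : ∀ {y} → y ≢ v → remove S v y ≡ S y
      rest-member {y} y≢v rewrite dec-false (y ≟ v) y≢v = Boolₚ.∧-identityʳ (S y)

      later : ∀ {y} → y ≢ v → 1 ≤ r y → cur < r y
      later y≢v 1≤ry = R.inside _ (R.ranked⇒member _ 1≤ry)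

      above⇒member : ∀ w → cur < ρ w → S w ≡ true
      above⇒member w cur<ρw with w ≟ v
      ... | yes refl = Sv
      ... | no w≢v = trans (sym (rest-member w≢v))
                          (R.ranked⇒member w (ℕₚ.≤-trans (s≤s z≤n) cur<ρw))

      outside : ∀ x → S x ≡ false → ρ x ≡ 0
      outside x Sx with x ≟ v
      ... | yes refl = ⊥-elim (Boolₚ.not-¬ Sv Sx)
      ... | no x≢v = R.outside x (trans (rest-member x≢v) Sx)

      inside : ∀ x → S x ≡ true → cur ≤ ρ x
      inside x Sx with x ≟ v
      ... | yes refl = ℕₚ.≤-refl
      ... | no x≢v = ℕₚ.<⇒≤ (R.inside x (trans (rest-member x≢v) Sx))

      bounded : ∀ x → ρ x ≤ bound
      bounded x with x ≟ v
      ... | yes refl = cur≤bound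
      ... | no x≢v = R.bounded x

      injective : ∀ x y → 1 ≤ ρ x → ρ x ≡ ρ y → x ≡ y
      injective x y 1≤ρx ρx≡ρy with x ≟ v | y ≟ v
      ... | yes refl | yes refl = refl
      ... | yes refl | no y≢v = ⊥-elim (ℕₚ.<-irrefl ρx≡ρy (later y≢v (subst (1 ≤_) ρx≡ρy 1≤ρx)))
      ... | no x≢v | yes refl = ⊥-elim (ℕₚ.<-irrefl (sym ρx≡ρy) (later x≢v 1≤ρx))
      ... | no x≢v | no y≢v = R.injective x y 1≤ρx ρx≡ρy

      firstSparse : upDegree ρ v ≤ d
      firstSparse = ℕₚ.≤-trans (sumℕ-mono λ e → indicator-≤ (upEdge? ρ v e) (inInduced e)) v-sparse
        where
        ρv≡cur = assign-≡ v cur r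
        inInduced : ∀ e → UpEdge ρ v e → 1 ≤ (if inducedEdges S e then ⟦ incident? G v e ⟧ else 0)
        inInduced e (inj₁ (refl , lt)) =
          inducedDegree-term S v e Sv (above⇒member _ (subst (_< ρ (head G e)) ρv≡cur lt)) (incident?-tail e)
        inInduced e (inj₂ (refl , lt)) =
          inducedDegree-term S v e (above⇒member _ (subst (_< ρ (tail G e)) ρv≡cur lt)) Sv (incident?-head e)

      laterSparse : ∀ x → x ≢ v → 1 ≤ r x → upDegree ρ x ≤ d
      laterSparse x x≢v 1≤rx =
        ℕₚ.≤-trans (sumℕ-mono λ e → indicator-≤ (upEdge? ρ x e) (1≤indicator (upEdge? r x e) ∘ still-up e))
                   (R.sparse x 1≤rx)
        where
        ρx≡rx = assign-≢ cur r x≢v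
        compare : ∀ w → ρ x < ρ w → r x < r w
        compare w lt with w ≟ v
        ... | yes refl = ⊥-elim (ℕₚ.<-asym (later x≢v 1≤rx) (subst (_< cur) ρx≡rx lt))
        ... | no w≢v = subst (_< r w) ρx≡rx lt
        still-up : ∀ e → UpEdge ρ x e → UpEdge r x e
        still-up e (inj₁ (t≡x , lt)) = inj₁ (t≡x , compare _ lt)
        still-up e (inj₂ (h≡x , lt)) = inj₂ (h≡x , compare _ lt)

      sparse : ∀ x → 1 ≤ ρ x → upDegree ρ x ≤ d
      sparse x 1≤ρx = byCases (x ≟ v)
        where
        byCases : Dec (x ≡ v) → upDegree ρ x ≤ d
        byCases (yes refl) = firstSparse
        byCases (no x≢v) = laterSparse x x≢v (subst (1 ≤_) (assign-≢ cur r x≢v) 1≤ρx)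

    ranking : ∀ f S cur → size S ≡ f → ∃ (IsRanking d S cur (cur + f))
    ranking f S cur size≡f with any? (λ x → S x Bool.≟ true)
    ... | no S-empty = (λ _ → 0) , emptyRanking S cur (cur + f) S-empty
    ranking zero S cur size≡0 | yes (x , Sx) =
      ⊥-elim (ℕₚ.0≢1+n (trans (sym size≡0) (size-remove S x Sx)))
    ranking (suc f) S cur size≡1+f | yes nonempty
      with degenerate S (inducedEdges S) (inducedEdges-isSubgraph S) nonempty
    ... | v , Sv , v-sparse
      with ranking f (remove S v) (suc cur) (ℕₚ.suc-injective (trans (sym (size-remove S v Sv)) size≡1+f))
    ...   | r , rest = assign v cur r , rankFirst v Sv v-sparse (ℕₚ.m≤m+n cur (suc f)) rest′
      where rest′ = subst (λ b → IsRanking d (remove S v) (suc cur) b r) (sym (ℕₚ.+-suc cur f)) rest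

-- The ranked matrix

NonzeroPermanentMod : ℕ → ∀ {n m} → OGraph n m → Set
NonzeroPermanentMod k {m = m} G =
  ∃ λ (A : Fin m → Fin m → ℤ) → EdgeColumnCombination G A × ¬ (+ k ∣ per A)

module RankedColumns {n m} (G : OGraph n m) (connected : Connected G) {k} (k-prime : Prime k)
  {d} (d<k : d < k) (R : Fin n → Bool) (z : Fin n) (z-root : R z ≡ true)
  (independent : ∀ e → R (tail G e) ≡ false ⊎ R (head G e) ≡ false)
  (rootEdges<k : sumℕ (λ e → ⟦ R (tail G e) ∨ R (head G e) ⟧) < k)
  (κ : Fin m → ℤ) (κ-nonroot : ∀ x → R x ≡ false → potential G κ x ≡ 0ℤ)
  (κ-root : ∀ x → R x ≡ true → ¬ (+ k ∣ potential G κ x))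
  {N r} (ranking : IsRanking G d (not ∘ R) 1 N r) where

  open IsRanking ranking

  root⇒rank≡0 : ∀ {x} → R x ≡ true → r x ≡ 0
  root⇒rank≡0 Rx = outside _ (cong not Rx)

  ranked⇒nonroot : ∀ {x} → 1 ≤ r x → R x ≡ false
  ranked⇒nonroot 1≤rx = trans (sym (Boolₚ.not-involutive _)) (cong not (ranked⇒member _ 1≤rx))

  rank≡0⇒root : ∀ {x} → r x ≡ 0 → R x ≡ true
  rank≡0⇒root {x} rx≡0 with R x in Rx
  ... | true = refl
  ... | false = ⊥-elim (ℕₚ.<⇒≢ (inside x (cong not Rx)) (sym rx≡0))

  sameRank⇒≡ : ∀ {x y} → r x ≡ r y → R x ≡ false ⊎ R y ≡ false → x ≡ y
  sameRank⇒≡ {x} {y} rx≡ry (inj₁ Rx) = injective x y (inside x (cong not Rx)) rx≡ry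
  sameRank⇒≡ {x} {y} rx≡ry (inj₂ Ry) = sym (injective y x (inside y (cong not Ry)) (sym rx≡ry))

  record RankedEnds (e : Fin m) : Set where
    field
      lower upper : Fin n
      ends        : (lower ≡ tail G e × upper ≡ head G e) ⊎ (lower ≡ head G e × upper ≡ tail G e)
      lower<upper : r lower < r upper

  rankedEnds : ∀ e → RankedEnds e
  rankedEnds e with ℕₚ.<-cmp (r (tail G e)) (r (head G e))
  ... | tri< t<h _ _ = record { lower = tail G e ; upper = head G e ; ends = inj₁ (refl , refl) ; lower<upper = t<h }
  ... | tri> _ _ h<t = record { lower = head G e ; upper = tail G e ; ends = inj₂ (refl , refl) ; lower<upper = h<t }
  ... | tri≈ _ t≡h _ = ⊥-elim (loopless G e (sameRank⇒≡ t≡h (independent e)))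

  module _ (e : Fin m) where
    open RankedEnds (rankedEnds e) public

    lower≤ : ∀ {x} → lower ≡ x ⊎ upper ≡ x → r lower ≤ r x
    lower≤ (inj₁ refl) = ℕₚ.≤-refl
    lower≤ (inj₂ refl) = ℕₚ.<⇒≤ lower<upper

    lower≤ends : r lower ≤ r (tail G e) × r lower ≤ r (head G e)
    lower≤ends with ends
    ... | inj₁ (l≡t , u≡h) = lower≤ (inj₁ l≡t) , lower≤ (inj₂ u≡h)
    ... | inj₂ (l≡h , u≡t) = lower≤ (inj₂ u≡t) , lower≤ (inj₁ l≡h)

    lower-isUpEdge : UpEdge G r lower e
    lower-isUpEdge with ends
    ... | inj₁ (l≡t , u≡h) = inj₁ (sym l≡t , subst (λ y → r lower < r y) u≡h lower<upper)
    ... | inj₂ (l≡h , u≡t) = inj₂ (sym l≡h , subst (λ y → r lower < r y) u≡t lower<upper)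

    lower-meetsRoots : R lower ≡ true → 1 ≤ ⟦ R (tail G e) ∨ R (head G e) ⟧
    lower-meetsRoots R-lower with ends
    ... | inj₁ (l≡t , _) = 1≤⟦∨⟧ (inj₁ (subst (λ y → R y ≡ true) l≡t R-lower))
    ... | inj₂ (l≡h , _) = 1≤⟦∨⟧ (inj₂ (subst (λ y → R y ≡ true) l≡h R-lower))

    ∤-acrossEdge : ∀ (φ : Fin n → ℤ) → φ upper ≡ 0ℤ → ¬ (+ k ∣ φ lower) →
                   ¬ (+ k ∣ φ (head G e) ℤ.- φ (tail G e))
    ∤-acrossEdge φ φu≡0 k∤φl = ∤-difference (φ (head G e)) (φ (tail G e)) (oriented ends)
      where
      oriented : _ → (φ (head G e) ≡ 0ℤ × ¬ (+ k ∣ φ (tail G e))) ⊎ (φ (tail G e) ≡ 0ℤ × ¬ (+ k ∣ φ (head G e)))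
      oriented (inj₁ (l≡t , u≡h)) = inj₁ (subst (λ y → φ y ≡ 0ℤ) u≡h φu≡0 , subst (λ y → ¬ (+ k ∣ φ y)) l≡t k∤φl)
      oriented (inj₂ (l≡h , u≡t)) = inj₂ (subst (λ y → φ y ≡ 0ℤ) u≡t φu≡0 , subst (λ y → ¬ (+ k ∣ φ y)) l≡h k∤φl)

    type : Fin (suc N)
    type = fromℕ< (s≤s (bounded lower))

    toℕ-type : toℕ type ≡ r lower
    toℕ-type = toℕ-fromℕ< (s≤s (bounded lower))

  rank-lower : ∀ {e t} → type e ≡ t → r (lower e) ≡ toℕ t
  rank-lower {e} type≡t = trans (sym (toℕ-type e)) (cong toℕ type≡t)

  z≢ranked : ∀ {x} → 1 ≤ r x → z ≢ x
  z≢ranked 1≤rx refl = ℕₚ.<⇒≢ 1≤rx (sym (root⇒rank≡0 z-root))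

  vertexColumn : ∀ {t} → Dec (∃ λ w → r w ≡ t) → Fin m → ℤ
  vertexColumn (yes (w , _)) = walkVector G (connected w z)
  vertexColumn (no _) _ = 0ℤ

  vertexColumn-vanishes : ∀ {t} (w? : Dec (∃ λ w → r w ≡ t)) x → t < r x →
                          potential G (vertexColumn w?) x ≡ 0ℤ
  vertexColumn-vanishes (no _) x _ = sumℤ-zero {m} (λ _ → refl)
  vertexColumn-vanishes (yes (w , refl)) x rw<rx =
    potential-walk-away G (connected w z) x (λ { refl → ℕₚ.<-irrefl refl rw<rx })
                        (z≢ranked (ℕₚ.≤-trans (s≤s z≤n) rw<rx))

  vertexColumn-pivot : ∀ {t} (w? : Dec (∃ λ w → r w ≡ t)) x → 1 ≤ t → r x ≡ t →
                       ¬ (+ k ∣ potential G (vertexColumn w?) x)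
  vertexColumn-pivot (no no-w) x _ rx≡t = ⊥-elim (no-w (x , rx≡t))
  vertexColumn-pivot (yes (w , rw≡t)) x 1≤t rx≡t
    with injective w x (subst (1 ≤_) (sym rw≡t) 1≤t) (trans rw≡t (sym rx≡t))
  ... | refl = ∤-unit k-prime (potential G (walkVector G (connected w z)) w)
                 (cong ℤ.∣_∣ (potential-walk-start G (connected w z) (z≢ranked 1≤rw ∘ sym)))
    where 1≤rw = subst (1 ≤_) (sym rw≡t) 1≤t

  vertexOfRank? : ∀ t → Dec (∃ λ w → r w ≡ t)
  vertexOfRank? t = any? (λ w → r w ℕ.≟ t)

  column : Fin (suc N) → Fin m → ℤ
  column zero = κ
  column (suc t) = vertexColumn (vertexOfRank? (suc (toℕ t)))

  column-vanishes : ∀ t x → toℕ t < r x → potential G (column t) x ≡ 0ℤ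
  column-vanishes zero x 0<rx = κ-nonroot x (ranked⇒nonroot 0<rx)
  column-vanishes (suc t) x = vertexColumn-vanishes (vertexOfRank? (suc (toℕ t))) x

  column-pivot : ∀ t x → r x ≡ toℕ t → ¬ (+ k ∣ potential G (column t) x)
  column-pivot zero x rx≡0 = κ-root x (rank≡0⇒root rx≡0)
  column-pivot (suc t) x = vertexColumn-pivot (vertexOfRank? (suc (toℕ t))) x (s≤s z≤n)

  entry : Fin m → Fin (suc N) → ℤ
  entry i t = sumℤ (λ g → column t g ℤ.* AG G i (inj₂ g))

  entry-triangular : Triangular entry type
  entry-triangular i t t<type = begin
    entry i t
      ≡⟨ edgeColumns≡potentialDifference G (column t) i ⟩
    potential G (column t) (head G i) ℤ.- potential G (column t) (tail G i)
      ≡⟨ cong₂ ℤ._-_ (column-vanishes t _ (ℕₚ.<-≤-trans t<lower (proj₂ (lower≤ends i))))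
                     (column-vanishes t _ (ℕₚ.<-≤-trans t<lower (proj₁ (lower≤ends i)))) ⟩
    0ℤ ∎
    where
    open ≡-Reasoning
    t<lower = subst (toℕ t <_) (toℕ-type i) t<type

  entry-pivot : ∀ i → ¬ (+ k ∣ entry i (type i))
  entry-pivot i = subst (λ y → ¬ (+ k ∣ y)) (sym (edgeColumns≡potentialDifference G (column (type i)) i))
    (∤-acrossEdge i (potential G (column (type i)))
      (column-vanishes (type i) _ (subst (_< r (upper i)) (sym (toℕ-type i)) (lower<upper i)))
      (column-pivot (type i) _ (sym (toℕ-type i))))

  count-type<k : ∀ t → count type t < k
  count-type<k zero = ℕₚ.≤-<-trans
    (sumℕ-mono λ e → indicator-≤ (type e ≟ zero) (lower-meetsRoots e ∘ rank≡0⇒root ∘ rank-lower))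
    rootEdges<k
  count-type<k (suc t) = vertexCount (vertexOfRank? (suc (toℕ t)))
    where
    vertexCount : Dec (∃ λ w → r w ≡ suc (toℕ t)) → count type (suc t) < k
    vertexCount (no no-w) = subst (_< k) (sym (sumℕ-zero λ e → δ-≢ (no-w ∘ (lower e ,_) ∘ rank-lower)))
                                  (ℕₚ.≤-<-trans z≤n d<k)
    vertexCount (yes (w , rw≡1+t)) =
      ℕₚ.≤-<-trans (ℕₚ.≤-trans (sumℕ-mono λ e → indicator-≤ (type e ≟ suc t) (is-up e))
                               (sparse w (subst (1 ≤_) (sym rw≡1+t) (s≤s z≤n))))
                   d<k
      where
      is-up : ∀ e → type e ≡ suc t → 1 ≤ ⟦ does (upEdge? G r w e) ⟧
      is-up e type≡ = 1≤indicator (upEdge? G r w e) (subst (λ y → UpEdge G r y e) lower≡w (lower-isUpEdge e))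
        where
        lower≡w = injective _ w (subst (1 ≤_) (sym (rank-lower type≡)) (s≤s z≤n))
                                (trans (rank-lower type≡) (sym rw≡1+t))

  nonzeroPermanent : NonzeroPermanentMod k G
  nonzeroPermanent = (λ i j → entry i (type j)) , ((λ g j → column (type j) g) , λ _ _ → refl) ,
                     per-triangular-∤ entry type k-prime entry-triangular count-type<k entry-pivot

-- The two cases

nonBipartite⇒nonzeroPermanent : ∀ {n m d k} (G : OGraph n m) → Connected G → Degenerate G d → Prime k →
                                d < k → 2 < k → ¬ Bipartite G → NonzeroPermanentMod k G
nonBipartite⇒nonzeroPermanent {zero} G _ _ _ _ _ not-bipartite =
  ⊥-elim (not-bipartite ((λ ()) , λ e → ⊥-elim (¬Fin0 (tail G e))))
nonBipartite⇒nonzeroPermanent {suc n} {m} {d} {k} G connected degenerate k-prime d<k 2<k not-bipartite =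
  RankedColumns.nonzeroPermanent G connected k-prime d<k R z z-root
    independent (ℕₚ.≤-<-trans z-sparse d<k) κ κ-nonroot κ-root (proj₂ ranking)
  where
  z-choice = degenerate (λ _ → true) (λ _ → true) (λ _ _ → refl , refl) (zero , refl)
  z = proj₁ z-choice
  z-sparse = proj₂ (proj₂ z-choice)

  R : Fin (suc n) → Bool
  R x = does (x ≟ z)

  z-root : R z ≡ true
  z-root = dec-true (z ≟ z) refl

  ranking = DegeneracyRanking.ranking G degenerate _ (not ∘ R) 1 refl

  independent : ∀ e → R (tail G e) ≡ false ⊎ R (head G e) ≡ false
  independent e with R (tail G e) in R-tail
  ... | false = inj₁ refl
  ... | true = inj₂ (dec-false (head G e ≟ z) (loopless G e ∘ trans (≟-true⇒≡ R-tail) ∘ sym))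

  colour : Fin (suc n) → Bool
  colour x = oddLength G (connected x z)

  monochromatic : ∃ λ e → colour (tail G e) ≡ colour (head G e)
  monochromatic with any? (λ e → colour (tail G e) Bool.≟ colour (head G e))
  ... | yes found = found
  ... | no none = ⊥-elim (not-bipartite (colour , λ e same → none (e , same)))

  e₀ = proj₁ monochromatic
  x₀ = tail G e₀
  W₁ W₂ : Walk G x₀ z
  W₁ = connected x₀ z
  W₂ = step (e₀ , inj₁ (refl , refl)) (connected (head G e₀) z)
  s = walkSign G W₁

  opposite-signs : walkSign G W₂ ≡ ℤ.- s
  opposite-signs = trans (walkSign-step G (e₀ , inj₁ (refl , refl)) (connected (head G e₀) z))
                         (cong (λ b → ℤ.- (if b then 1ℤ else -1ℤ)) (sym (proj₂ monochromatic)))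

  κ : Fin m → ℤ
  κ g = walkVector G W₁ g ℤ.- walkVector G W₂ g

  potential-κ : ∀ x → potential G κ x ≡ (s ℤ.+ s) ℤ.* δℤ z x
  potential-κ x = begin
    potential G κ x
      ≡⟨ potential-- G (walkVector G W₁) (walkVector G W₂) x ⟩
    potential G (walkVector G W₁) x ℤ.- potential G (walkVector G W₂) x
      ≡⟨ cong₂ ℤ._-_ (potential-walk G W₁ x) (potential-walk G W₂ x) ⟩
    (δℤ x₀ x ℤ.+ s ℤ.* δℤ z x) ℤ.- (δℤ x₀ x ℤ.+ walkSign G W₂ ℤ.* δℤ z x)
      ≡⟨ cong (λ s′ → (δℤ x₀ x ℤ.+ s ℤ.* δℤ z x) ℤ.- (δℤ x₀ x ℤ.+ s′ ℤ.* δℤ z x))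
              opposite-signs ⟩
    (δℤ x₀ x ℤ.+ s ℤ.* δℤ z x) ℤ.- (δℤ x₀ x ℤ.+ ℤ.- s ℤ.* δℤ z x)
      ≡⟨ cancel (δℤ x₀ x) s (δℤ z x) ⟩
    (s ℤ.+ s) ℤ.* δℤ z x ∎
    where
    open ≡-Reasoning
    cancel : ∀ a s c → (a ℤ.+ s ℤ.* c) ℤ.- (a ℤ.+ ℤ.- s ℤ.* c) ≡ (s ℤ.+ s) ℤ.* c
    cancel = solve-∀

  κ-nonroot : ∀ x → R x ≡ false → potential G κ x ≡ 0ℤ
  κ-nonroot x R-x = begin
    potential G κ x        ≡⟨ potential-κ x ⟩
    (s ℤ.+ s) ℤ.* δℤ z x   ≡⟨ cong (λ c → (s ℤ.+ s) ℤ.* + c) (δ-≢ z≢x) ⟩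
    (s ℤ.+ s) ℤ.* 0ℤ       ≡⟨ ℤₚ.*-zeroʳ (s ℤ.+ s) ⟩
    0ℤ                     ∎
    where
    open ≡-Reasoning
    z≢x : z ≢ x
    z≢x refl = Boolₚ.not-¬ z-root R-x

  κ-root : ∀ x → R x ≡ true → ¬ (+ k ∣ potential G κ x)
  κ-root x R-x =
    ∤-small (potential G κ x) (subst (0 <_) (sym ∣κ∣≡2) (s≤s z≤n)) (subst (_< k) (sym ∣κ∣≡2) 2<k)
    where
    open ≡-Reasoning
    ∣κ∣≡2 : ℤ.∣ potential G κ x ∣ ≡ 2
    ∣κ∣≡2 = begin
      ℤ.∣ potential G κ x ∣        ≡⟨ cong ℤ.∣_∣ (potential-κ x) ⟩
      ℤ.∣ (s ℤ.+ s) ℤ.* δℤ z x ∣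
        ≡⟨ cong (λ c → ℤ.∣ (s ℤ.+ s) ℤ.* + c ∣) (trans (cong (δ z) (≟-true⇒≡ R-x)) (δ-refl z)) ⟩
      ℤ.∣ (s ℤ.+ s) ℤ.* 1ℤ ∣       ≡⟨ cong ℤ.∣_∣ (ℤₚ.*-identityʳ (s ℤ.+ s)) ⟩
      ℤ.∣ s ℤ.+ s ∣                ≡⟨ ∣walkSign+walkSign∣≡2 G W₁ ⟩
      2                            ∎

nonadjacentPair⇒nonzeroPermanent : ∀ {n m d k} (G : OGraph n m) → Connected G → Degenerate G d → Prime k →
  d < k → ∀ u v → u ≢ v → ¬ Adjacent G u v → degree G u + degree G v < k → NonzeroPermanentMod k G
nonadjacentPair⇒nonzeroPermanent {n} {m} {d} {k} G connected degenerate k-prime d<k u v u≢v u≁v degrees<k =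
  RankedColumns.nonzeroPermanent G connected k-prime d<k R u u-root
    independent rootEdges<k κ κ-nonroot κ-root (proj₂ ranking)
  where
  R : Fin n → Bool
  R x = does (x ≟ u) ∨ does (x ≟ v)

  ranking = DegeneracyRanking.ranking G degenerate _ (not ∘ R) 1 refl

  u-root : R u ≡ true
  u-root = cong (_∨ does (u ≟ v)) (dec-true (u ≟ u) refl)

  v-root : R v ≡ true
  v-root = trans (cong (does (v ≟ u) ∨_) (dec-true (v ≟ v) refl)) (Boolₚ.∨-zeroʳ _)

  root≢nonroot : ∀ {a x} → R a ≡ true → R x ≡ false → a ≢ x
  root≢nonroot R-a R-x refl = Boolₚ.not-¬ R-a R-x

  root-cases : ∀ {x} → R x ≡ true → x ≡ u ⊎ x ≡ v
  root-cases {x} R-x with x ≟ u | x ≟ v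
  ... | yes x≡u | _ = inj₁ x≡u
  ... | no _ | yes x≡v = inj₂ x≡v

  nonroot : ∀ {x} → u ≢ x → v ≢ x → R x ≡ false
  nonroot {x} u≢x v≢x = cong₂ _∨_ (dec-false (x ≟ u) (u≢x ∘ sym)) (dec-false (x ≟ v) (v≢x ∘ sym))

  other-end : ∀ {e x y} → Joins G e x y → R x ≡ true → R y ≡ false
  other-end {e} {x} {y} x~y R-x with root-cases R-x
  ... | inj₁ x≡u = nonroot (λ u≡y → joins⇒≢ G x~y (trans x≡u u≡y))
                           (λ v≡y → u≁v (e , subst₂ (Joins G e) x≡u (sym v≡y) x~y))
  ... | inj₂ x≡v = nonroot (λ u≡y → u≁v (e , swap (subst₂ (Joins G e) x≡v (sym u≡y) x~y)))
                           (λ v≡y → joins⇒≢ G x~y (trans x≡v v≡y))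

  independent : ∀ e → R (tail G e) ≡ false ⊎ R (head G e) ≡ false
  independent e with R (tail G e) in R-tail
  ... | false = inj₁ refl
  ... | true = inj₂ (other-end (inj₁ (refl , refl)) R-tail)

  rootEdges<k : sumℕ (λ e → ⟦ R (tail G e) ∨ R (head G e) ⟧) < k
  rootEdges<k = begin-strict
    sumℕ (λ e → ⟦ R (tail G e) ∨ R (head G e) ⟧)
      ≤⟨ sumℕ-mono (λ e → ⟦∨∨⟧≤ (does (tail G e ≟ u)) (does (tail G e ≟ v))
                                (does (head G e ≟ u)) (does (head G e ≟ v))) ⟩
    sumℕ (λ e → ⟦ incident? G u e ⟧ + ⟦ incident? G v e ⟧)
      ≡⟨ sumℕ-+ (λ e → ⟦ incident? G u e ⟧) (λ e → ⟦ incident? G v e ⟧) ⟩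
    degree G u + degree G v
      <⟨ degrees<k ⟩
    k ∎
    where open ℕₚ.≤-Reasoning

  W = connected u v
  s = walkSign G W

  κ : Fin m → ℤ
  κ = walkVector G W

  κ-nonroot : ∀ x → R x ≡ false → potential G κ x ≡ 0ℤ
  κ-nonroot x R-x = potential-walk-away G W x (root≢nonroot u-root R-x) (root≢nonroot v-root R-x)

  κ-root : ∀ x → R x ≡ true → ¬ (+ k ∣ potential G κ x)
  κ-root x R-x = ∤-unit k-prime (potential G κ x) (∣potential∣≡1 (root-cases R-x))
    where
    ∣potential∣≡1 : x ≡ u ⊎ x ≡ v → ℤ.∣ potential G κ x ∣ ≡ 1
    ∣potential∣≡1 (inj₁ refl) = cong ℤ.∣_∣ (potential-walk-start G W u≢v)
    ∣potential∣≡1 (inj₂ refl) = trans (cong ℤ.∣_∣ (potential-walk-end G W u≢v)) (∣walkSign∣≡1 G W)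

lemma3 : (n m d k : ℕ) (G : OGraph n m) →
    Connected G → Degenerate G d → Prime k → d < k → 2 ≤ d →
    (¬ Bipartite G ⊎
      (Bipartite G × ∃ λ u → ∃ λ v → u ≢ v × ¬ Adjacent G u v × degree G u + degree G v < k)) →
    ∃ λ (A : Fin m → Fin m → ℤ) → EdgeColumnCombination G A × ¬ ((+ k) ∣ per A)
lemma3 n m d k G connected degenerate k-prime d<k 2≤d (inj₁ not-bipartite) =
  nonBipartite⇒nonzeroPermanent G connected degenerate k-prime d<k (ℕₚ.≤-<-trans 2≤d d<k) not-bipartite
-- Case (ii) does not need bipartiteness.
lemma3 n m d k G connected degenerate k-prime d<k 2≤d (inj₂ (_ , u , v , u≢v , u≁v , degrees<k)) =
  nonadjacentPair⇒nonzeroPermanent G connected degenerate k-prime d<k u v u≢v u≁v degrees<k
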